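{- Let $K$ be a finite simplicial complex, $s\ge1$, and $S,T\subseteq F^s(K)$. (1) If $S$ and $T$ are closed, then $S\cap T$ is closed. (2) If all connected components of $S$ and all connected components of $T$ are closed, then all connected components of $S\cap T$ are closed.
   Context: $F^s(K)$ is the set of $s$-simplices (faces with $s+1$ vertices) of $K$. For $S\subseteq F^s(K)$, its connected components are the equivalence classes of the smallest equivalence relation on $S$ relating any two simplices with nonempty intersection. $V(S)=\bigcup S$. A set $S\subseteq F^s(K)$ is closed if $\{\sigma\in F^s(K)\mid\sigma\subseteq V(S)\}=S$. -}

module Defs where

open import Data.Nat using (ℕ; suc)
open import Data.Fin using (Fin)
open import Data.Fin.Subset using (Subset; _∈_; _⊆_; ∣_∣; Nonempty)
  renaming (_∩_ to _∩ˢ_)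
open import Data.Product using (Σ; _×_)
open import Relation.Binary.PropositionalEquality using (_≡_)
open import Relation.Binary.Construct.Closure.ReflexiveTransitive using (Star)

record Complex (n : ℕ) : Set₁ where
  field
    face          : Subset n → Set
    face-nonempty : ∀ σ → face σ → Nonempty σ
    face-down     : ∀ σ τ → face σ → τ ⊆ σ → Nonempty τ → face τ
open Complex public

SimpSet : ℕ → Set₁
SimpSet n = Subset n → Set

F : ∀ {n} → ℕ → Complex n → SimpSet n
F s K σ = face K σ × ∣ σ ∣ ≡ suc s

_⊆F[_]_ : ∀ {n} → SimpSet n → ℕ → Complex n → Set
S ⊆F[ s ] K = ∀ σ → S σ → F s K σ

_∩S_ : ∀ {n} → SimpSet n → SimpSet n → SimpSet n
(S ∩S T) σ = S σ × T σ

V : ∀ {n} → SimpSet n → Fin n → Set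
V S v = Σ (Subset _) (λ σ → S σ × v ∈ σ)

_⊆V_ : ∀ {n} → Subset n → SimpSet n → Set
σ ⊆V S = ∀ v → v ∈ σ → V S v

-- S is closed: {σ ∈ F^s(K) | σ ⊆ V(S)} = S (as an equality of sets)
Closed : ∀ {n} → Complex n → ℕ → SimpSet n → Set
Closed K s S =
  (∀ σ → F s K σ → σ ⊆V S → S σ) × (∀ σ → S σ → F s K σ × σ ⊆V S)

Adj : ∀ {n} → SimpSet n → Subset n → Subset n → Set
Adj S σ τ = S σ × S τ × Nonempty (σ ∩ˢ τ)

-- the connected component of S containing σ (for σ ∈ S): the class of σ under
-- the smallest equivalence relation on S containing Adj S
-- (reflexive-transitive closure of the symmetric relation Adj S).
Component : ∀ {n} → SimpSet n → Subset n → SimpSet n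
Component S σ τ = S τ × Star (Adj S) σ τ

ComponentsClosed : ∀ {n} → Complex n → ℕ → SimpSet n → Set
ComponentsClosed K s S = ∀ σ → S σ → Closed K s (Component S σ)

-- Closedness only asks that every s-simplex covered by V(S) already lies in S;
-- since V is monotone and S ∩ T is contained in both S and T, such a simplex of
-- K lies in S and in T. For components the same argument places τ in S ∩ T;
-- a vertex of τ lies on some simplex of the component of σ, which meets τ, so
-- τ is joined to σ inside S ∩ T.
module Submission where

open import Defs
open import Data.Nat using (ℕ; _≤_)
open import Data.Product using (_×_; _,_; proj₁; proj₂)
open import Data.Fin.Subset using (Nonempty)
open import Data.Fin.Subset.Properties using (x∈p∩q⁺)
open import Relation.Unary using (_⊆_)
open import Relation.Binary using (_⇒_)
open import Relation.Binary.Construct.Closure.ReflexiveTransitive as Star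
  using (Star; ε; _◅_; _◅◅_)

module _ {n : ℕ} where

  ⊆V-self : ∀ {S : SimpSet n} {σ} → S σ → σ ⊆V S
  ⊆V-self {σ = σ} σ∈S v v∈σ = σ , σ∈S , v∈σ

  ⊆V-mono : ∀ {S S′ : SimpSet n} {σ} → S ⊆ S′ → σ ⊆V S → σ ⊆V S′
  ⊆V-mono S⊆S′ σ⊆VS v v∈σ with σ⊆VS v v∈σ
  ... | ρ , ρ∈S , v∈ρ = ρ , S⊆S′ ρ∈S , v∈ρ

  Adj-mono : ∀ {S S′ : SimpSet n} → S ⊆ S′ → Adj S ⇒ Adj S′
  Adj-mono S⊆S′ (σ∈S , τ∈S , σ∩τ≢∅) = S⊆S′ σ∈S , S⊆S′ τ∈S , σ∩τ≢∅

  Component-mono : ∀ {S S′ : SimpSet n} {σ} → S ⊆ S′ → Component S σ ⊆ Component S′ σ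
  Component-mono S⊆S′ (τ∈S , σ⋯τ) = S⊆S′ τ∈S , Star.map (Adj-mono S⊆S′) σ⋯τ

  Component⊆ : ∀ {S : SimpSet n} {σ} → Component S σ ⊆ S
  Component⊆ = proj₁

  Component-absorbs : ∀ {S : SimpSet n} {σ τ} → S τ → Nonempty τ →
                      τ ⊆V Component S σ → Component S σ τ
  Component-absorbs τ∈S (v , v∈τ) τ⊆VC with τ⊆VC v v∈τ
  ... | ρ , (ρ∈S , σ⋯ρ) , v∈ρ =
    τ∈S , σ⋯ρ ◅◅ ((ρ∈S , τ∈S , v , x∈p∩q⁺ (v∈ρ , v∈τ)) ◅ ε)

module _ {n : ℕ} (K : Complex n) (s : ℕ) where

  Saturated : SimpSet n → Set
  Saturated S = ∀ σ → F s K σ → σ ⊆V S → S σ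

  mkClosed : ∀ {S} → S ⊆F[ s ] K → Saturated S → Closed K s S
  mkClosed S⊆F sat = sat , λ σ σ∈S → S⊆F σ σ∈S , ⊆V-self σ∈S

  Saturated-∩ : ∀ {S T} → Saturated S → Saturated T → Saturated (S ∩S T)
  Saturated-∩ satS satT σ σ∈F σ⊆V =
    satS σ σ∈F (⊆V-mono proj₁ σ⊆V) , satT σ σ∈F (⊆V-mono proj₂ σ⊆V)

  Closed-∩ : ∀ {S T} → S ⊆F[ s ] K → Closed K s S → Closed K s T →
             Closed K s (S ∩S T)
  Closed-∩ S⊆F (satS , _) (satT , _) =
    mkClosed (λ σ σ∈S∩T → S⊆F σ (proj₁ σ∈S∩T)) (Saturated-∩ satS satT)

  ComponentsClosed-∩ : ∀ {S T} → S ⊆F[ s ] K →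
                       ComponentsClosed K s S → ComponentsClosed K s T →
                       ComponentsClosed K s (S ∩S T)
  ComponentsClosed-∩ {S} {T} S⊆F ccS ccT σ (σ∈S , σ∈T) =
    mkClosed (λ τ τ∈C → S⊆F τ (proj₁ (Component⊆ τ∈C))) saturated
    where
    saturated : Saturated (Component (S ∩S T) σ)
    saturated τ τ∈F τ⊆VC =
      Component-absorbs (τ∈S , τ∈T) (face-nonempty K τ (proj₁ τ∈F)) τ⊆VC
      where
      τ∈S : S τ
      τ∈S = Component⊆ (proj₁ (ccS σ σ∈S) τ τ∈F (⊆V-mono (Component-mono proj₁) τ⊆VC))
      τ∈T : T τ
      τ∈T = Component⊆ (proj₁ (ccT σ σ∈T) τ τ∈F (⊆V-mono (Component-mono proj₂) τ⊆VC))

lemma2p15 : ∀ {n} (K : Complex n) (s : ℕ) → 1 ≤ s →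
    (S T : SimpSet n) → S ⊆F[ s ] K → T ⊆F[ s ] K →
    ((Closed K s S → Closed K s T → Closed K s (S ∩S T))
     × (ComponentsClosed K s S → ComponentsClosed K s T →
        ComponentsClosed K s (S ∩S T)))
lemma2p15 K s _ S T S⊆F _ = Closed-∩ K s S⊆F , ComponentsClosed-∩ K s S⊆F
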